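{- Let $d$ be a positive integer, let \[ A_d(q)=\sum_{k_1=0}^{\infty}\sum_{k_2=0}^{k_1+1}\cdots\sum_{k_d=0}^{k_{d-1}+1}q^{k_1+k_2+\cdots+k_d}, \] and let $\alpha_d(q)=A_d(q)\,(q;q)_d$, which is a polynomial in $q$ with integer coefficients. Then $\alpha_d(1)=1$.
   Context: $(q;q)_d=\prod_{r=1}^{d}(1-q^r)$ denotes the $q$-Pochhammer symbol. -}

module Defs where

open import Data.Nat as ℕ using (ℕ; zero; suc; _∸_; _≤?_; _≟_)
open import Data.Integer as ℤ using (ℤ; +_; -_; _+_; _*_)
open import Relation.Nullary using (yes; no)

-- Formal power series with integer coefficients, represented by their
-- coefficient function: f n = coefficient of q^n.
Series : Set
Series = ℕ → ℤ

sumUpTo : (ℕ → ℤ) → ℕ → ℤ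
sumUpTo f zero    = f 0
sumUpTo f (suc n) = sumUpTo f n + f (suc n)

sumUpToℕ : (ℕ → ℕ) → ℕ → ℕ
sumUpToℕ f zero    = f 0
sumUpToℕ f (suc n) = sumUpToℕ f n ℕ.+ f (suc n)

_⊛_ : Series → Series → Series
(f ⊛ g) n = sumUpTo (λ j → f j * g (n ∸ j)) n

-- The polynomial 1 - q^r  (for r ≥ 1)
oneMinusQPow : ℕ → Series
oneMinusQPow r n with n ≟ 0
... | yes _ = + 1
... | no _ with n ≟ r
...   | yes _ = - (+ 1)
...   | no _  = + 0

oneS : Series
oneS zero    = + 1
oneS (suc _) = + 0

qPoch : ℕ → Series
qPoch zero    = oneS
qPoch (suc d) = qPoch d ⊛ oneMinusQPow (suc d)

-- cnt d b n = number of tuples (k_1,…,k_d) of naturals with k_1 ≤ b,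
-- k_i ≤ k_{i-1} + 1 for 2 ≤ i ≤ d, and k_1 + … + k_d = n.
cnt : ℕ → ℕ → ℕ → ℕ
cnt zero    b n with n ≟ 0
... | yes _ = 1
... | no _  = 0
cnt (suc d) b n = sumUpToℕ term b
  where
  term : ℕ → ℕ
  term k with k ≤? n
  ... | yes _ = cnt d (suc k) (n ∸ k)
  ... | no _  = 0

-- Coefficients of A_d(q) = Σ_{k_1≥0} Σ_{k_2=0}^{k_1+1} ⋯ Σ_{k_d=0}^{k_{d-1}+1} q^{k_1+⋯+k_d}.
-- (Since all k_i ≥ 0, a tuple of sum n has k_1 ≤ n, so bounding k_1 by n is exact.)
A : ℕ → Series
A d n = + (cnt d n n)

α : ℕ → Series
α d = A d ⊛ qPoch d

module Submission where

-- Write Atrunc d b for the part of A_d with k₁ < b. Splitting off k₁ = b gives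
-- Atrunc (d+1) (b+1) = Atrunc (d+1) b + q^b Atrunc d (b+2), and by induction on d, for all b,
--   Atrunc d b · (q;q)_d = Σ_{j=0}^{d} (-1)^j q^{j(j-1+b)} [d choose j]_q α_{d-j}.
-- In the induction step, the left side and the j ≥ 1 part of the right side grow by the
-- same amount from b to b+1 (by the induction hypothesis and the q-absorption identity
-- (1-q^j)[d+1 choose j]_q = (1-q^{d+1})[d choose j-1]_q), so their difference does not
-- depend on b. Below degree b the left side agrees with A_{d+1}(q;q)_{d+1} = α_{d+1} and
-- the j ≥ 1 terms vanish, so the difference is α_{d+1}. Comparing with b = 0, where the
-- left side is 0, gives α_{d+1} = -Σ_{j≥1} (-1)^j q^{j(j-1)} [d+1 choose j]_q α_{d+1-j};
-- so by strong induction every α_d is a polynomial, with α_d(1) = -Σ_{j≥1} (-1)^j C(d+1, j) = 1.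

open import Defs
open import Algebra.Bundles using (CommutativeRing)
import Algebra.Construct.Pointwise as Pointwise
import Algebra.Properties.Semiring.Sum as Sum
open import Algebra.Solver.Ring.AlmostCommutativeRing
  using (AlmostCommutativeRing; _-Raw-AlmostCommutative⟶_; fromCommutativeRing)
open import Data.Fin using (Fin; toℕ)
open import Data.Fin.Properties using (toℕ≤pred[n])
open import Data.Integer as ℤ using (ℤ; +_; -_; _+_; _*_; _-_; _^_; -1ℤ)
import Data.Integer.Properties as ℤ
open import Data.Integer.Tactic.RingSolver using (solve-∀)
open import Data.Maybe using (Maybe; just; nothing)
open import Data.Nat as ℕ using (ℕ; zero; suc; _<_; _≤_; _∸_; z≤n; s≤s; _≤?_; _≟_)
open import Data.Nat.Combinatorics using (_C_; nCn≡1; nCk+nC[k+1]≡[n+1]C[k+1]; k>n⇒nCk≡0)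
open import Data.Nat.Induction using (<-rec)
import Data.Nat.Properties as ℕ
import Data.Nat.Tactic.RingSolver as ℕ-Solver
open import Data.Product using (∃-syntax; _×_; _,_)
open import Data.Sum using (inj₁; inj₂)
open import Function using (_∘_)
open import Level using (0ℓ)
open import Relation.Binary.PropositionalEquality
  using (_≡_; _≗_; _≢_; refl; sym; trans; cong; cong₂; subst; module ≡-Reasoning)
import Relation.Binary.Reasoning.Setoid as SetoidReasoning
open import Relation.Nullary using (yes; no)
open import Relation.Nullary.Negation using (contradiction)

module _ where
  open ≡-Reasoning

  sumUpTo-cong : ∀ {f g : ℕ → ℤ} n → (∀ i → i ≤ n → f i ≡ g i) →
                 sumUpTo f n ≡ sumUpTo g n
  sumUpTo-cong zero    f≡g = f≡g 0 z≤n
  sumUpTo-cong (suc n) f≡g =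
    cong₂ _+_ (sumUpTo-cong n (λ i i≤n → f≡g i (ℕ.m≤n⇒m≤1+n i≤n))) (f≡g (suc n) ℕ.≤-refl)

  sumUpTo-zero : ∀ {f : ℕ → ℤ} n → (∀ i → i ≤ n → f i ≡ + 0) → sumUpTo f n ≡ + 0
  sumUpTo-zero zero    f≡0 = f≡0 0 z≤n
  sumUpTo-zero (suc n) f≡0 =
    cong₂ _+_ (sumUpTo-zero n (λ i i≤n → f≡0 i (ℕ.m≤n⇒m≤1+n i≤n))) (f≡0 (suc n) ℕ.≤-refl)

  sumUpTo-distrib-+ : ∀ (f g : ℕ → ℤ) n →
                      sumUpTo (λ i → f i + g i) n ≡ sumUpTo f n + sumUpTo g n
  sumUpTo-distrib-+ f g zero    = refl
  sumUpTo-distrib-+ f g (suc n) = begin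
    sumUpTo (λ i → f i + g i) n + (f (suc n) + g (suc n))
      ≡⟨ cong (_+ (f (suc n) + g (suc n))) (sumUpTo-distrib-+ f g n) ⟩
    (sumUpTo f n + sumUpTo g n) + (f (suc n) + g (suc n))
      ≡⟨ interchange (sumUpTo f n) (sumUpTo g n) (f (suc n)) (g (suc n)) ⟩
    (sumUpTo f n + f (suc n)) + (sumUpTo g n + g (suc n)) ∎
    where
    interchange : ∀ a b c d → (a + b) + (c + d) ≡ (a + c) + (b + d)
    interchange = solve-∀

  sumUpTo-neg : ∀ (f : ℕ → ℤ) n → sumUpTo (λ i → - f i) n ≡ - sumUpTo f n
  sumUpTo-neg f zero    = refl
  sumUpTo-neg f (suc n) =
    trans (cong (_+ - f (suc n)) (sumUpTo-neg f n)) (sym (ℤ.neg-distrib-+ (sumUpTo f n) (f (suc n))))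

  *-distribˡ-sumUpTo : ∀ c (f : ℕ → ℤ) n → c * sumUpTo f n ≡ sumUpTo (λ i → c * f i) n
  *-distribˡ-sumUpTo c f zero    = refl
  *-distribˡ-sumUpTo c f (suc n) =
    trans (ℤ.*-distribˡ-+ c (sumUpTo f n) (f (suc n))) (cong (_+ c * f (suc n)) (*-distribˡ-sumUpTo c f n))

  *-distribʳ-sumUpTo : ∀ c (f : ℕ → ℤ) n → sumUpTo f n * c ≡ sumUpTo (λ i → f i * c) n
  *-distribʳ-sumUpTo c f n = begin
    sumUpTo f n * c                ≡⟨ ℤ.*-comm (sumUpTo f n) c ⟩
    c * sumUpTo f n                ≡⟨ *-distribˡ-sumUpTo c f n ⟩
    sumUpTo (λ i → c * f i) n      ≡⟨ sumUpTo-cong n (λ i _ → ℤ.*-comm c (f i)) ⟩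
    sumUpTo (λ i → f i * c) n      ∎

  sumUpTo-suc : ∀ (f : ℕ → ℤ) n → sumUpTo f (suc n) ≡ f 0 + sumUpTo (f ∘ suc) n
  sumUpTo-suc f zero    = refl
  sumUpTo-suc f (suc n) =
    trans (cong (_+ f (suc (suc n))) (sumUpTo-suc f n)) (ℤ.+-assoc (f 0) _ _)

  sumUpTo-reverse : ∀ (f : ℕ → ℤ) n → sumUpTo f n ≡ sumUpTo (λ i → f (n ∸ i)) n
  sumUpTo-reverse f zero    = refl
  sumUpTo-reverse f (suc n) = begin
    sumUpTo f n + f (suc n)
      ≡⟨ cong (_+ f (suc n)) (sumUpTo-reverse f n) ⟩
    sumUpTo (λ i → f (n ∸ i)) n + f (suc n)
      ≡⟨ ℤ.+-comm _ (f (suc n)) ⟩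
    f (suc n) + sumUpTo (λ i → f (n ∸ i)) n
      ≡⟨ sumUpTo-suc (λ i → f (suc n ∸ i)) n ⟨
    sumUpTo (λ i → f (suc n ∸ i)) (suc n) ∎

  sumUpTo-beyond : ∀ (f : ℕ → ℤ) {N M} → N ≤ M → (∀ i → N < i → f i ≡ + 0) →
                   sumUpTo f M ≡ sumUpTo f N
  sumUpTo-beyond f {N} {zero}  z≤n f≡0 = refl
  sumUpTo-beyond f {N} {suc M} N≤1+M f≡0 with ℕ.m≤n⇒m<n∨m≡n N≤1+M
  ... | inj₁ (s≤s N≤M) =
    trans (cong₂ _+_ (sumUpTo-beyond f N≤M f≡0) (f≡0 (suc M) (s≤s N≤M))) (ℤ.+-identityʳ _)
  ... | inj₂ refl = refl

  sumUpTo-triangle : ∀ (F : ℕ → ℕ → ℤ) n →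
    sumUpTo (λ i → sumUpTo (F i) i) n ≡ sumUpTo (λ j → sumUpTo (λ k → F (j ℕ.+ k) j) (n ∸ j)) n
  sumUpTo-triangle F zero    = refl
  sumUpTo-triangle F (suc n) = begin
    sumUpTo (λ i → sumUpTo (F i) i) n + (sumUpTo (F (suc n)) n + F (suc n) (suc n))
      ≡⟨ cong (_+ (sumUpTo (F (suc n)) n + F (suc n) (suc n))) (sumUpTo-triangle F n) ⟩
    sumUpTo (columns n) n + (sumUpTo (F (suc n)) n + F (suc n) (suc n))
      ≡⟨ ℤ.+-assoc (sumUpTo (columns n) n) _ _ ⟨
    (sumUpTo (columns n) n + sumUpTo (F (suc n)) n) + F (suc n) (suc n)
      ≡⟨ cong₂ _+_ (sym (sumUpTo-distrib-+ (columns n) (F (suc n)) n)) diagonal ⟩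
    sumUpTo (λ j → columns n j + F (suc n) j) n + columns (suc n) (suc n)
      ≡⟨ cong (_+ columns (suc n) (suc n)) (sumUpTo-cong n extend) ⟩
    sumUpTo (columns (suc n)) n + columns (suc n) (suc n) ∎
    where
    columns : ℕ → ℕ → ℤ
    columns m j = sumUpTo (λ k → F (j ℕ.+ k) j) (m ∸ j)
    diagonal : F (suc n) (suc n) ≡ columns (suc n) (suc n)
    diagonal = begin
      F (suc n) (suc n)                                ≡⟨ cong (λ i → F i (suc n)) (ℕ.+-identityʳ (suc n)) ⟨
      F (suc n ℕ.+ 0) (suc n)                          ≡⟨ cong (sumUpTo (λ k → F (suc n ℕ.+ k) (suc n))) (ℕ.n∸n≡0 n) ⟨
      columns (suc n) (suc n)                          ∎
    extend : ∀ j → j ≤ n → columns n j + F (suc n) j ≡ columns (suc n) j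
    extend j j≤n = begin
      columns n j + F (suc n) j
        ≡⟨ cong (λ i → columns n j + F i j) (trans (ℕ.+-suc j (n ∸ j)) (cong suc (ℕ.m+[n∸m]≡n j≤n))) ⟨
      columns n j + F (j ℕ.+ suc (n ∸ j)) j
        ≡⟨ cong (sumUpTo (λ k → F (j ℕ.+ k) j)) (ℕ.+-∸-assoc 1 j≤n) ⟨
      columns (suc n) j ∎

  -- With w i = h (n ∸ i) this gives associativity of ⊛; with w = 1, that evaluation
  -- at q = 1 is multiplicative.
  sumUpTo-⊛ : ∀ (f g w : Series) n →
    sumUpTo (λ i → (f ⊛ g) i * w i) n ≡
    sumUpTo (λ j → f j * sumUpTo (λ k → g k * w (j ℕ.+ k)) (n ∸ j)) n
  sumUpTo-⊛ f g w n = begin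
    sumUpTo (λ i → (f ⊛ g) i * w i) n
      ≡⟨ sumUpTo-cong n (λ i _ → *-distribʳ-sumUpTo (w i) (λ j → f j * g (i ∸ j)) i) ⟩
    sumUpTo (λ i → sumUpTo (λ j → f j * g (i ∸ j) * w i) i) n
      ≡⟨ sumUpTo-triangle (λ i j → f j * g (i ∸ j) * w i) n ⟩
    sumUpTo (λ j → sumUpTo (λ k → f j * g (j ℕ.+ k ∸ j) * w (j ℕ.+ k)) (n ∸ j)) n
      ≡⟨ sumUpTo-cong n (λ j _ → trans (sumUpTo-cong (n ∸ j) (λ k _ → regroup j k))
                                        (sym (*-distribˡ-sumUpTo (f j) _ (n ∸ j)))) ⟩
    sumUpTo (λ j → f j * sumUpTo (λ k → g k * w (j ℕ.+ k)) (n ∸ j)) n ∎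
    where
    regroup : ∀ j k → f j * g (j ℕ.+ k ∸ j) * w (j ℕ.+ k) ≡ f j * (g k * w (j ℕ.+ k))
    regroup j k = trans (cong (λ m → f j * g m * w (j ℕ.+ k)) (ℕ.m+n∸m≡n j k))
                        (ℤ.*-assoc (f j) (g k) (w (j ℕ.+ k)))

-- The ring of formal power series

infixl 6 _⊕_
infix  25 ⊝_

_⊕_ : Series → Series → Series
(f ⊕ g) n = f n + g n

⊝_ : Series → Series
(⊝ f) n = - f n

0ₛ : Series
0ₛ _ = + 0

⊛-cong : ∀ {f f′ g g′} → f ≗ f′ → g ≗ g′ → f ⊛ g ≗ f′ ⊛ g′
⊛-cong f≗f′ g≗g′ n = sumUpTo-cong n (λ j _ → cong₂ _*_ (f≗f′ j) (g≗g′ (n ∸ j)))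

⊛-comm : ∀ f g → f ⊛ g ≗ g ⊛ f
⊛-comm f g n = trans (sumUpTo-reverse _ n) (sumUpTo-cong n swap)
  where
  swap : ∀ j → j ≤ n → f (n ∸ j) * g (n ∸ (n ∸ j)) ≡ g j * f (n ∸ j)
  swap j j≤n = trans (cong (λ i → f (n ∸ j) * g i) (ℕ.m∸[m∸n]≡n j≤n)) (ℤ.*-comm (f (n ∸ j)) (g j))

⊛-identityˡ : ∀ f → oneS ⊛ f ≗ f
⊛-identityˡ f zero    = ℤ.*-identityˡ (f 0)
⊛-identityˡ f (suc n) = begin
  (oneS ⊛ f) (suc n)
    ≡⟨ sumUpTo-suc (λ j → oneS j * f (suc n ∸ j)) n ⟩
  + 1 * f (suc n) + sumUpTo (λ i → + 0 * f (n ∸ i)) n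
    ≡⟨ cong₂ _+_ (ℤ.*-identityˡ (f (suc n))) (sumUpTo-zero n (λ i _ → ℤ.*-zeroˡ (f (n ∸ i)))) ⟩
  f (suc n) + + 0
    ≡⟨ ℤ.+-identityʳ (f (suc n)) ⟩
  f (suc n) ∎
  where open ≡-Reasoning

⊛-distribˡ-⊕ : ∀ f g h → f ⊛ (g ⊕ h) ≗ f ⊛ g ⊕ f ⊛ h
⊛-distribˡ-⊕ f g h n =
  trans (sumUpTo-cong n (λ j _ → ℤ.*-distribˡ-+ (f j) (g (n ∸ j)) (h (n ∸ j))))
        (sumUpTo-distrib-+ _ _ n)

⊛-identityʳ : ∀ f → f ⊛ oneS ≗ f
⊛-identityʳ f n = trans (⊛-comm f oneS n) (⊛-identityˡ f n)

⊛-distribʳ-⊕ : ∀ f g h → (g ⊕ h) ⊛ f ≗ g ⊛ f ⊕ h ⊛ f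
⊛-distribʳ-⊕ f g h n =
  trans (⊛-comm (g ⊕ h) f n) (trans (⊛-distribˡ-⊕ f g h n) (cong₂ _+_ (⊛-comm f g n) (⊛-comm f h n)))

⊛-assoc : ∀ f g h → (f ⊛ g) ⊛ h ≗ f ⊛ (g ⊛ h)
⊛-assoc f g h n =
  trans (sumUpTo-⊛ f g (λ i → h (n ∸ i)) n)
        (sumUpTo-cong n (λ j _ → cong (f j *_) (sumUpTo-cong (n ∸ j) (λ k _ →
          cong (λ m → g k * h m) (sym (ℕ.∸-+-assoc n j k))))))

⊕-⊛-commutativeRing : CommutativeRing 0ℓ 0ℓ
⊕-⊛-commutativeRing = record
  { Carrier = Series
  ; _≈_ = _≗_
  ; _+_ = _⊕_
  ; _*_ = _⊛_
  ; -_ = ⊝_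
  ; 0# = 0ₛ
  ; 1# = oneS
  ; isCommutativeRing = record
    { isRing = record
      { +-isAbelianGroup = Pointwise.isAbelianGroup ℕ ℤ.+-0-isAbelianGroup
      ; *-cong = ⊛-cong
      ; *-assoc = ⊛-assoc
      ; *-identity = ⊛-identityˡ , ⊛-identityʳ
      ; distrib = ⊛-distribˡ-⊕ , ⊛-distribʳ-⊕
      }
    ; *-comm = ⊛-comm
    }
  }

module Series = CommutativeRing ⊕-⊛-commutativeRing
module ≗-Reasoning = SetoidReasoning Series.setoid

constant : ℤ → Series
constant c zero    = c
constant c (suc n) = + 0

constant-+ : ∀ a b → constant (a + b) ≗ constant a ⊕ constant b
constant-+ a b zero    = refl
constant-+ a b (suc n) = refl

constant-* : ∀ a b → constant (a * b) ≗ constant a ⊛ constant b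
constant-* a b zero    = refl
constant-* a b (suc n) = sym (trans (sumUpTo-suc _ n)
  (cong₂ _+_ (ℤ.*-zeroʳ a) (sumUpTo-zero n (λ i _ → ℤ.*-zeroˡ (constant b (n ∸ i))))))

constant-neg : ∀ a → constant (- a) ≗ ⊝ constant a
constant-neg a zero    = refl
constant-neg a (suc n) = refl

constant-1 : constant (+ 1) ≗ oneS
constant-1 zero    = refl
constant-1 (suc n) = refl

constant-0 : constant (+ 0) ≗ 0ₛ
constant-0 zero    = refl
constant-0 (suc n) = refl

⊕-⊛-almostCommutativeRing : AlmostCommutativeRing 0ℓ 0ℓ
⊕-⊛-almostCommutativeRing = fromCommutativeRing ⊕-⊛-commutativeRing

constant-homomorphism : ℤ.+-*-rawRing -Raw-AlmostCommutative⟶ ⊕-⊛-almostCommutativeRing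
constant-homomorphism = record
  { ⟦_⟧    = constant
  ; +-homo = constant-+
  ; *-homo = constant-*
  ; -‿homo = constant-neg
  ; 0-homo = constant-0
  ; 1-homo = constant-1
  }

constant-≟ : ∀ a b → Maybe (constant a ≗ constant b)
constant-≟ a b with a ℤ.≟ b
... | yes refl = just (λ _ → refl)
... | no _     = nothing

open import Algebra.Solver.Ring ℤ.+-*-rawRing ⊕-⊛-almostCommutativeRing constant-homomorphism constant-≟
  using (solve; _:=_; _:+_; _:*_; _:-_; :-_; _:^_)

shift : ℕ → Series → Series
shift zero    f n       = f n
shift (suc k) f zero    = + 0
shift (suc k) f (suc n) = shift k f n

shift-cong : ∀ k {f g} → f ≗ g → shift k f ≗ shift k g
shift-cong zero    f≗g n       = f≗g n
shift-cong (suc k) f≗g zero    = refl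
shift-cong (suc k) f≗g (suc n) = shift-cong k f≗g n

shift-below : ∀ k f {n} → n < k → shift k f n ≡ + 0
shift-below (suc k) f {zero}  _         = refl
shift-below (suc k) f {suc n} (s≤s n<k) = shift-below k f n<k

shift-∸ : ∀ k f {n} → k ≤ n → shift k f n ≡ f (n ∸ k)
shift-∸ zero    f _         = refl
shift-∸ (suc k) f (s≤s k≤n) = shift-∸ k f k≤n

shift-shift : ∀ j k f → shift j (shift k f) ≗ shift (j ℕ.+ k) f
shift-shift zero    k f n       = refl
shift-shift (suc j) k f zero    = refl
shift-shift (suc j) k f (suc n) = shift-shift j k f n

shift-⊛ : ∀ k f g → shift k f ⊛ g ≗ shift k (f ⊛ g)
shift-⊛ zero    f g n       = refl
shift-⊛ (suc k) f g zero    = ℤ.*-zeroˡ (g 0)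
shift-⊛ (suc k) f g (suc n) = begin
  (shift (suc k) f ⊛ g) (suc n)
    ≡⟨ sumUpTo-suc (λ j → shift (suc k) f j * g (suc n ∸ j)) n ⟩
  + 0 * g (suc n) + (shift k f ⊛ g) n
    ≡⟨ ℤ.+-identityˡ ((shift k f ⊛ g) n) ⟩
  (shift k f ⊛ g) n
    ≡⟨ shift-⊛ k f g n ⟩
  shift k (f ⊛ g) n ∎
  where open ≡-Reasoning

infix 30 q^_

q^_ : ℕ → Series
q^ k = shift k oneS

q^-⊛ : ∀ k f → q^ k ⊛ f ≗ shift k f
q^-⊛ k f n = trans (shift-⊛ k oneS f n) (shift-cong k (⊛-identityˡ f) n)

q^-+ : ∀ j k → q^ j ⊛ q^ k ≗ q^ (j ℕ.+ k)
q^-+ j k n = trans (q^-⊛ j (q^ k) n) (shift-shift j k oneS n)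

q^-cong : ∀ {j k} → j ≡ k → q^ j ≗ q^ k
q^-cong j≡k n = cong (λ k → (q^ k) n) j≡k

q^-diagonal : ∀ k → (q^ k) k ≡ + 1
q^-diagonal k = trans (shift-∸ k oneS ℕ.≤-refl) (cong oneS (ℕ.n∸n≡0 k))

q^-off-diagonal : ∀ k {n} → n ≢ k → (q^ k) n ≡ + 0
q^-off-diagonal zero    {zero}  n≢k = contradiction refl n≢k
q^-off-diagonal zero    {suc n} n≢k = refl
q^-off-diagonal (suc k) {zero}  n≢k = refl
q^-off-diagonal (suc k) {suc n} n≢k = q^-off-diagonal k (n≢k ∘ cong suc)

infix 8 1-_

1-_ : Series → Series
1- u = oneS ⊕ ⊝ u

1-‿cong : ∀ {u v} → u ≗ v → 1- u ≗ 1- v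
1-‿cong u≗v n = cong (λ c → oneS n + - c) (u≗v n)

oneMinusQPow-suc : ∀ r → oneMinusQPow (suc r) ≗ 1- q^ (suc r)
oneMinusQPow-suc r zero = refl
oneMinusQPow-suc r (suc m) with suc m ≟ suc r
... | yes m≡r = cong (λ c → + 0 + - c) (sym (trans (cong (q^ (suc r)) m≡r) (q^-diagonal (suc r))))
... | no  m≢r = cong (λ c → + 0 + - c) (sym (q^-off-diagonal (suc r) m≢r))

qPoch-suc : ∀ d → qPoch (suc d) ≗ qPoch d ⊛ (1- q^ (suc d))
qPoch-suc d = ⊛-cong {f = qPoch d} (λ _ → refl) (oneMinusQPow-suc d)

-- Gaussian binomial coefficients

-- qBinomial a b is the Gaussian binomial [a + b choose a]_q.
qBinomial : ℕ → ℕ → Series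
qBinomial zero    b       = oneS
qBinomial (suc a) zero    = oneS
qBinomial (suc a) (suc b) = qBinomial a (suc b) ⊕ q^ (suc a) ⊛ qBinomial (suc a) b

qBinomial-zeroʳ : ∀ a → qBinomial a 0 ≗ oneS
qBinomial-zeroʳ zero    _ = refl
qBinomial-zeroʳ (suc a) _ = refl

c[x+uy]≈cx+u[cy] : ∀ c u x y → c ⊛ (x ⊕ u ⊛ y) ≗ c ⊛ x ⊕ u ⊛ (c ⊛ y)
c[x+uy]≈cx+u[cy] = solve 4 (λ c u x y → c :* (x :+ u :* y) := c :* x :+ u :* (c :* y)) Series.refl

-- The solver identities write 1 as u :^ 0, which evaluates to oneS, whereas a solver
-- constant evaluates to a constant series that is not definitionally oneS.
[1-u]x+u[1-v]x≈[1-uv]x : ∀ u v x → (1- u) ⊛ x ⊕ u ⊛ ((1- v) ⊛ x) ≗ (1- u ⊛ v) ⊛ x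
[1-u]x+u[1-v]x≈[1-uv]x = solve 3
  (λ u v x → (u :^ 0 :- u) :* x :+ u :* ((u :^ 0 :- v) :* x) := (u :^ 0 :- u :* v) :* x) Series.refl

qBinomial-absorptionˡ : ∀ a b → (1- q^ (suc a)) ⊛ qBinomial (suc a) b ≗ (1- q^ (suc (a ℕ.+ b))) ⊛ qBinomial a b
qBinomial-absorptionʳ : ∀ a b → (1- q^ (suc b)) ⊛ qBinomial a (suc b) ≗ (1- q^ (suc (a ℕ.+ b))) ⊛ qBinomial a b

qBinomial-absorptionˡ a zero =
  Series.*-cong (1-‿cong (q^-cong (cong suc (sym (ℕ.+-identityʳ a)))))
                (Series.sym (qBinomial-zeroʳ a))
qBinomial-absorptionˡ a (suc b) = begin
  (1- u) ⊛ (x ⊕ u ⊛ y)         ≈⟨ c[x+uy]≈cx+u[cy] (1- u) u x y ⟩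
  (1- u) ⊛ x ⊕ u ⊛ ((1- u) ⊛ y) ≈⟨ Series.+-congˡ {(1- u) ⊛ x} (Series.*-congˡ {u} (Series.trans (qBinomial-absorptionˡ a b)
                                                               (Series.sym (qBinomial-absorptionʳ a b)))) ⟩
  (1- u) ⊛ x ⊕ u ⊛ ((1- v) ⊛ x) ≈⟨ [1-u]x+u[1-v]x≈[1-uv]x u v x ⟩
  (1- u ⊛ v) ⊛ x               ≈⟨ Series.*-congʳ {x} (1-‿cong (q^-+ (suc a) (suc b))) ⟩
  (1- q^ (suc (a ℕ.+ suc b))) ⊛ x ∎
  where
  open ≗-Reasoning
  u = q^ (suc a)
  v = q^ (suc b)
  x = qBinomial a (suc b)
  y = qBinomial (suc a) b
qBinomial-absorptionʳ zero b = Series.refl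
qBinomial-absorptionʳ (suc a) b = begin
  (1- v) ⊛ (x ⊕ u ⊛ y)         ≈⟨ c[x+uy]≈cx+u[cy] (1- v) u x y ⟩
  (1- v) ⊛ x ⊕ u ⊛ ((1- v) ⊛ y) ≈⟨ Series.+-congʳ {u ⊛ ((1- v) ⊛ y)} (Series.trans (qBinomial-absorptionʳ a b)
                                                               (Series.sym (qBinomial-absorptionˡ a b))) ⟩
  (1- u) ⊛ y ⊕ u ⊛ ((1- v) ⊛ y) ≈⟨ [1-u]x+u[1-v]x≈[1-uv]x u v y ⟩
  (1- u ⊛ v) ⊛ y               ≈⟨ Series.*-congʳ {y} (1-‿cong (Series.trans (q^-+ (suc a) (suc b)) exponent)) ⟩
  (1- q^ (suc (suc a ℕ.+ b))) ⊛ y ∎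
  where
  open ≗-Reasoning
  u = q^ (suc a)
  v = q^ (suc b)
  x = qBinomial a (suc b)
  y = qBinomial (suc a) b
  exponent : q^ (suc a ℕ.+ suc b) ≗ q^ (suc (suc a ℕ.+ b))
  exponent = q^-cong (cong suc (ℕ.+-suc a b))

-- Truncations of A_d

-- Atrunc d b is the generating function of the tuples counted by A d with k₁ < b; the
-- tuples with k₁ = b contribute q^b times the tuples (k₂, …, k_d) with k₂ < b + 2.
Atrunc : ℕ → ℕ → Series
Atrunc zero    b       = oneS
Atrunc (suc d) zero    = 0ₛ
Atrunc (suc d) (suc b) = Atrunc (suc d) b ⊕ shift b (Atrunc d (suc (suc b)))

-- Defs binds the summand of cnt (suc d) b n in a where block; it is recovered here
-- by unifying sumUpToℕ t b with the unfolding of cnt (suc d) b n.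
cnt-summand : ℕ → ℕ → ℕ → ℕ → ℕ
cnt-summand d b n = summand (refl {x = cnt (suc d) b n})
  where
  summand : ∀ {t : ℕ → ℕ} → sumUpToℕ t b ≡ sumUpToℕ t b → ℕ → ℕ
  summand {t} _ = t

cnt-summand-≤ : ∀ d b {n k} → k ≤ n → cnt-summand d b n k ≡ cnt d (suc k) (n ∸ k)
cnt-summand-≤ d b {n} {k} k≤n with k ≤? n
... | yes _   = refl
... | no  k≰n = contradiction k≤n k≰n

cnt-summand-irrelevant : ∀ d b b′ n k → cnt-summand d b n k ≡ cnt-summand d b′ n k
cnt-summand-irrelevant d b b′ n k with k ≤? n
... | yes _ = refl
... | no  _ = refl

sumUpToℕ-cong : ∀ {f g : ℕ → ℕ} n → (∀ i → f i ≡ g i) → sumUpToℕ f n ≡ sumUpToℕ g n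
sumUpToℕ-cong zero    f≡g = f≡g 0
sumUpToℕ-cong (suc n) f≡g = cong₂ ℕ._+_ (sumUpToℕ-cong n f≡g) (f≡g (suc n))

cnt-suc-suc : ∀ d b n → cnt (suc d) (suc b) n ≡ cnt (suc d) b n ℕ.+ cnt-summand d (suc b) n (suc b)
cnt-suc-suc d b n = cong (ℕ._+ cnt-summand d (suc b) n (suc b))
                         (sumUpToℕ-cong b (cnt-summand-irrelevant d (suc b) b n))

shift-cnt : ∀ d b {n k} {f : Series} → (∀ m → f m ≡ + cnt d (suc k) m) →
            shift k f n ≡ + cnt-summand d b n k
shift-cnt d b {n} {k} f≡cnt with k ≤? n
... | yes k≤n = trans (shift-∸ k _ k≤n) (f≡cnt (n ∸ k))
... | no  k≰n = shift-below k _ (ℕ.≰⇒> k≰n)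

Atrunc-cnt : ∀ d b n → Atrunc d (suc b) n ≡ + cnt d b n
Atrunc-cnt zero    b       zero    = refl
Atrunc-cnt zero    b       (suc n) = refl
Atrunc-cnt (suc d) zero    n =
  trans (ℤ.+-identityˡ _) (trans (Atrunc-cnt d 1 n) (cong +_ (sym (cnt-summand-≤ d 0 z≤n))))
Atrunc-cnt (suc d) (suc b) n = begin
  Atrunc (suc d) (suc b) n + shift (suc b) (Atrunc d (suc (suc (suc b)))) n
    ≡⟨ cong₂ _+_ (Atrunc-cnt (suc d) b n) (shift-cnt d (suc b) {n} (Atrunc-cnt d (suc (suc b)))) ⟩
  + cnt (suc d) b n + + cnt-summand d (suc b) n (suc b)
    ≡⟨ ℤ.pos-+ (cnt (suc d) b n) _ ⟨
  + (cnt (suc d) b n ℕ.+ cnt-summand d (suc b) n (suc b))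
    ≡⟨ cong +_ (cnt-suc-suc d b n) ⟨
  + cnt (suc d) (suc b) n ∎
  where open ≡-Reasoning

Atrunc-suc : ∀ d {b n} → n < b → Atrunc d (suc b) n ≡ Atrunc d b n
Atrunc-suc zero    n<b = refl
Atrunc-suc (suc d) {b} {n} n<b =
  trans (cong (λ c → Atrunc (suc d) b n + c) (shift-below b _ n<b)) (ℤ.+-identityʳ _)

Atrunc-A : ∀ d {b n} → n < b → Atrunc d b n ≡ A d n
Atrunc-A d {suc b} {n} (s≤s n≤b) with ℕ.m≤n⇒m<n∨m≡n n≤b
... | inj₁ n<b  = trans (Atrunc-suc d n<b) (Atrunc-A d n<b)
... | inj₂ refl = Atrunc-cnt d n n

α-Atrunc : ∀ d n → α d n ≡ (Atrunc d (suc n) ⊛ qPoch d) n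
α-Atrunc d n = sumUpTo-cong n (λ j j≤n → cong (_* qPoch d (n ∸ j)) (sym (Atrunc-A d (s≤s j≤n))))

-- The expansion of Atrunc d b ⊛ (q;q)_d

module Σₛ = Sum Series.semiring
module Σℤ = Sum ℤ.+-*-semiring

coefficient-sum : ∀ {m} (fs : Fin m → Series) n → Σₛ.sum fs n ≡ Σℤ.sum (λ i → fs i n)
coefficient-sum {zero}  fs n = refl
coefficient-sum {suc m} fs n = cong (λ c → fs Fin.zero n + c) (coefficient-sum (fs ∘ Fin.suc) n)

sign : ℕ → Series
sign zero    = oneS
sign (suc i) = ⊝ sign i

exponent : ℕ → ℕ → ℕ
exponent zero    b = 0
exponent (suc i) b = suc i ℕ.* (i ℕ.+ b)

exponent-suc : ∀ i b → exponent (suc i) (suc b) ≡ exponent (suc i) b ℕ.+ suc i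
exponent-suc = polynomial-identity
  where
  polynomial-identity : ∀ i b → suc i ℕ.* (i ℕ.+ suc b) ≡ suc i ℕ.* (i ℕ.+ b) ℕ.+ suc i
  polynomial-identity = ℕ-Solver.solve-∀

exponent-split : ∀ i b → b ℕ.+ exponent i (suc (suc b)) ≡ exponent (suc i) b
exponent-split zero    b = refl
exponent-split (suc i) b = polynomial-identity i b
  where
  polynomial-identity : ∀ i b → b ℕ.+ suc i ℕ.* (i ℕ.+ suc (suc b)) ≡ suc (suc i) ℕ.* (suc i ℕ.+ b)
  polynomial-identity = ℕ-Solver.solve-∀

term : ℕ → ℕ → ℕ → Series
term d b j = q^ (exponent j b) ⊛ (sign j ⊛ (qBinomial j (d ∸ j) ⊛ α (d ∸ j)))

expansion : ℕ → ℕ → Series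
expansion d b = Σₛ.sum {suc d} (λ j → term d b (toℕ j))

expansionTail : ℕ → ℕ → Series
expansionTail d b = Σₛ.sum {d} (λ j → term d b (suc (toℕ j)))

term-zero : ∀ d b → term d b 0 ≗ α d
term-zero d b n =
  trans (q^-⊛ 0 (oneS ⊛ (oneS ⊛ α d)) n) (trans (⊛-identityˡ (oneS ⊛ α d) n) (⊛-identityˡ (α d) n))

term-below : ∀ d b i {n} → n < b → term d b (suc i) n ≡ + 0
term-below d b i {n} n<b =
  trans (q^-⊛ (exponent (suc i) b) (sign (suc i) ⊛ (qBinomial (suc i) (d ∸ suc i) ⊛ α (d ∸ suc i))) n)
        (shift-below _ _ n<exponent)
  where
  n<exponent : n < exponent (suc i) b
  n<exponent = ℕ.<-≤-trans n<b (ℕ.≤-trans (ℕ.m≤m+n b _) (ℕ.≤-reflexive (exponent-split i b)))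

expansionTail-below : ∀ d {b n} → n < b → expansionTail d b n ≡ + 0
expansionTail-below d {b} {n} n<b = begin
  expansionTail d b n                       ≡⟨ coefficient-sum {d} (λ j → term d b (suc (toℕ j))) n ⟩
  Σℤ.sum {d} (λ j → term d b (suc (toℕ j)) n) ≡⟨ Σℤ.sum-cong-≗ {d} (λ j → term-below d b (toℕ j) n<b) ⟩
  Σℤ.sum {d} (λ _ → + 0)                                 ≡⟨ Σℤ.sum-replicate-zero d ⟩
  + 0                                                    ∎
  where open ≡-Reasoning

[eu][-s[Qa]]≈e[-s[Qa]]+e[s[[1-u]Q]a] : ∀ e u s Q a →
  (e ⊛ u) ⊛ (⊝ s ⊛ (Q ⊛ a)) ≗ e ⊛ (⊝ s ⊛ (Q ⊛ a)) ⊕ e ⊛ (s ⊛ (((1- u) ⊛ Q) ⊛ a))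
[eu][-s[Qa]]≈e[-s[Qa]]+e[s[[1-u]Q]a] = solve 5 (λ e u s Q a →
  (e :* u) :* (:- s :* (Q :* a)) := e :* (:- s :* (Q :* a)) :+ e :* (s :* (((u :^ 0 :- u) :* Q) :* a)))
  Series.refl

[ab][c[[dq]r]]≈a[d[b[c[qr]]]] : ∀ a b c d q r →
  (a ⊛ b) ⊛ (c ⊛ ((d ⊛ q) ⊛ r)) ≗ a ⊛ (d ⊛ (b ⊛ (c ⊛ (q ⊛ r))))
[ab][c[[dq]r]]≈a[d[b[c[qr]]]] = solve 6 (λ a b c d q r →
  (a :* b) :* (c :* ((d :* q) :* r)) := a :* (d :* (b :* (c :* (q :* r))))) Series.refl

term-step : ∀ d b i → i ≤ d →
  term (suc d) (suc b) (suc i) ≗ term (suc d) b (suc i) ⊕ q^ b ⊛ ((1- q^ (suc d)) ⊛ term d (suc (suc b)) i)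
term-step d b i i≤d = begin
  q^ (exponent (suc i) (suc b)) ⊛ ((⊝ s) ⊛ (Q₁ ⊛ a))
    ≈⟨ Series.*-congʳ {(⊝ s) ⊛ (Q₁ ⊛ a)} exponent-suc-split ⟩
  (e ⊛ u) ⊛ ((⊝ s) ⊛ (Q₁ ⊛ a))
    ≈⟨ [eu][-s[Qa]]≈e[-s[Qa]]+e[s[[1-u]Q]a] e u s Q₁ a ⟩
  e ⊛ ((⊝ s) ⊛ (Q₁ ⊛ a)) ⊕ e ⊛ (s ⊛ (((1- u) ⊛ Q₁) ⊛ a))
    ≈⟨ Series.+-congˡ {e ⊛ ((⊝ s) ⊛ (Q₁ ⊛ a))} (Series.*-cong exponent-split′
         (Series.*-congˡ {s} (Series.*-congʳ {a} absorption))) ⟩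
  e ⊛ ((⊝ s) ⊛ (Q₁ ⊛ a)) ⊕ (q^ b ⊛ e′) ⊛ (s ⊛ (((1- q^ (suc d)) ⊛ Q₀) ⊛ a))
    ≈⟨ Series.+-congˡ {e ⊛ ((⊝ s) ⊛ (Q₁ ⊛ a))} ([ab][c[[dq]r]]≈a[d[b[c[qr]]]] (q^ b) e′ s (1- q^ (suc d)) Q₀ a) ⟩
  e ⊛ ((⊝ s) ⊛ (Q₁ ⊛ a)) ⊕ q^ b ⊛ ((1- q^ (suc d)) ⊛ (e′ ⊛ (s ⊛ (Q₀ ⊛ a)))) ∎
  where
  open ≗-Reasoning
  e  = q^ (exponent (suc i) b)
  e′ = q^ (exponent i (suc (suc b)))
  u  = q^ (suc i)
  s  = sign i
  a  = α (d ∸ i)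
  Q₀ = qBinomial i (d ∸ i)
  Q₁ = qBinomial (suc i) (d ∸ i)
  exponent-suc-split : q^ (exponent (suc i) (suc b)) ≗ e ⊛ u
  exponent-suc-split = Series.sym (Series.trans (q^-+ (exponent (suc i) b) (suc i)) (q^-cong (sym (exponent-suc i b))))
  exponent-split′ : e ≗ q^ b ⊛ e′
  exponent-split′ = Series.sym (Series.trans (q^-+ b (exponent i (suc (suc b)))) (q^-cong (exponent-split i b)))
  absorption : (1- u) ⊛ Q₁ ≗ (1- q^ (suc d)) ⊛ Q₀
  absorption = Series.trans (qBinomial-absorptionˡ i (d ∸ i))
                            (Series.*-congʳ {Q₀} (1-‿cong (q^-cong (cong suc (ℕ.m+[n∸m]≡n i≤d)))))

expansionTail-step : ∀ d b → expansionTail (suc d) (suc b) ≗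
  expansionTail (suc d) b ⊕ q^ b ⊛ ((1- q^ (suc d)) ⊛ expansion d (suc (suc b)))
expansionTail-step d b = begin
  Σₛ.sum {suc d} (λ j → term (suc d) (suc b) (suc (toℕ j)))
    ≈⟨ Σₛ.sum-cong-≋ {suc d} (λ j → term-step d b (toℕ j) (toℕ≤pred[n] j)) ⟩
  Σₛ.sum {suc d} (λ j → term (suc d) b (suc (toℕ j)) ⊕ shifted j)
    ≈⟨ Σₛ.∑-distrib-+ (λ j → term (suc d) b (suc (toℕ j))) shifted ⟩
  expansionTail (suc d) b ⊕ Σₛ.sum shifted
    ≈⟨ Series.+-congˡ {expansionTail (suc d) b} factor-out ⟨
  expansionTail (suc d) b ⊕ q^ b ⊛ (D ⊛ expansion d (suc (suc b))) ∎
  where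
  open ≗-Reasoning
  D = 1- q^ (suc d)
  shifted : Fin (suc d) → Series
  shifted j = q^ b ⊛ (D ⊛ term d (suc (suc b)) (toℕ j))
  factor-out : q^ b ⊛ (D ⊛ expansion d (suc (suc b))) ≗ Σₛ.sum shifted
  factor-out = Series.trans (Series.*-congˡ {q^ b} (Σₛ.*-distribˡ-sum {suc d} D (λ j → term d (suc (suc b)) (toℕ j))))
                            (Σₛ.*-distribˡ-sum {suc d} (q^ b) (λ j → D ⊛ term d (suc (suc b)) (toℕ j)))

[x+z]-[y+z]≈x-y : ∀ x y z → (x ⊕ z) ⊕ ⊝ (y ⊕ z) ≗ x ⊕ ⊝ y
[x+z]-[y+z]≈x-y = solve 3 (λ x y z → (x :+ z) :- (y :+ z) := x :- y) Series.refl

x≈[x-y]+y : ∀ x y → x ≗ (x ⊕ ⊝ y) ⊕ y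
x≈[x-y]+y = solve 2 (λ x y → x := (x :- y) :+ y) Series.refl

difference-constant : ∀ (f g h : ℕ → Series) →
  (∀ b → f (suc b) ≗ f b ⊕ h b) → (∀ b → g (suc b) ≗ g b ⊕ h b) →
  ∀ b → f b ⊕ ⊝ g b ≗ f 0 ⊕ ⊝ g 0
difference-constant f g h f-step g-step zero    = Series.refl
difference-constant f g h f-step g-step (suc b) = begin
  f (suc b) ⊕ ⊝ g (suc b)       ≈⟨ Series.+-cong (f-step b) (Series.-‿cong (g-step b)) ⟩
  (f b ⊕ h b) ⊕ ⊝ (g b ⊕ h b)   ≈⟨ [x+z]-[y+z]≈x-y (f b) (g b) (h b) ⟩
  f b ⊕ ⊝ g b                   ≈⟨ difference-constant f g h f-step g-step b ⟩
  f 0 ⊕ ⊝ g 0                   ∎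
  where open ≗-Reasoning

module _ (d : ℕ) (expansion-d : ∀ b → Atrunc d b ⊛ qPoch d ≗ expansion d b) where

  Atrunc-step : ∀ b → Atrunc (suc d) (suc b) ⊛ qPoch (suc d) ≗
    Atrunc (suc d) b ⊛ qPoch (suc d) ⊕ q^ b ⊛ ((1- q^ (suc d)) ⊛ expansion d (suc (suc b)))
  Atrunc-step b = begin
    (Atrunc (suc d) b ⊕ shift b B) ⊛ qPoch (suc d)
      ≈⟨ Series.*-cong (Series.+-congˡ {Atrunc (suc d) b} (Series.sym (q^-⊛ b B))) (qPoch-suc d) ⟩
    (Atrunc (suc d) b ⊕ q^ b ⊛ B) ⊛ (qPoch d ⊛ D)
      ≈⟨ [x+mc][pD]≈x[pD]+m[D[cp]] (Atrunc (suc d) b) (q^ b) B (qPoch d) D ⟩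
    Atrunc (suc d) b ⊛ (qPoch d ⊛ D) ⊕ q^ b ⊛ (D ⊛ (B ⊛ qPoch d))
      ≈⟨ Series.+-cong (Series.*-congˡ {Atrunc (suc d) b} (Series.sym (qPoch-suc d)))
                       (Series.*-congˡ {q^ b} (Series.*-congˡ {D} (expansion-d (suc (suc b))))) ⟩
    Atrunc (suc d) b ⊛ qPoch (suc d) ⊕ q^ b ⊛ (D ⊛ expansion d (suc (suc b))) ∎
    where
    open ≗-Reasoning
    B = Atrunc d (suc (suc b))
    D = 1- q^ (suc d)
    [x+mc][pD]≈x[pD]+m[D[cp]] : ∀ x m c p D → (x ⊕ m ⊛ c) ⊛ (p ⊛ D) ≗ x ⊛ (p ⊛ D) ⊕ m ⊛ (D ⊛ (c ⊛ p))
    [x+mc][pD]≈x[pD]+m[D[cp]] = solve 5 (λ x m c p D →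
      (x :+ m :* c) :* (p :* D) := x :* (p :* D) :+ m :* (D :* (c :* p))) Series.refl

  Atrunc-minus-tail : ∀ b → Atrunc (suc d) b ⊛ qPoch (suc d) ⊕ ⊝ expansionTail (suc d) b ≗ ⊝ expansionTail (suc d) 0
  Atrunc-minus-tail b = begin
    Atrunc (suc d) b ⊛ P ⊕ ⊝ T b  ≈⟨ difference-constant (λ c → Atrunc (suc d) c ⊛ P) T increment
                                      Atrunc-step (expansionTail-step d) b ⟩
    0ₛ ⊛ P ⊕ ⊝ T 0                ≈⟨ Series.+-congʳ {⊝ T 0} (Series.zeroˡ P) ⟩
    0ₛ ⊕ ⊝ T 0                    ≈⟨ Series.+-identityˡ (⊝ T 0) ⟩
    ⊝ T 0                         ∎
    where
    open ≗-Reasoning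
    P = qPoch (suc d)
    T = expansionTail (suc d)
    increment : ℕ → Series
    increment c = q^ c ⊛ ((1- q^ (suc d)) ⊛ expansion d (suc (suc c)))

  α-suc : α (suc d) ≗ ⊝ expansionTail (suc d) 0
  α-suc n = begin
    α (suc d) n
      ≡⟨ α-Atrunc (suc d) n ⟩
    (Atrunc (suc d) (suc n) ⊛ qPoch (suc d)) n
      ≡⟨ x≈[x-y]+y (Atrunc (suc d) (suc n) ⊛ qPoch (suc d)) (expansionTail (suc d) (suc n)) n ⟩
    (Atrunc (suc d) (suc n) ⊛ qPoch (suc d) ⊕ ⊝ expansionTail (suc d) (suc n)) n + expansionTail (suc d) (suc n) n
      ≡⟨ cong₂ _+_ (Atrunc-minus-tail (suc n) n) (expansionTail-below (suc d) {suc n} ℕ.≤-refl) ⟩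
    - expansionTail (suc d) 0 n + + 0
      ≡⟨ ℤ.+-identityʳ _ ⟩
    - expansionTail (suc d) 0 n ∎
    where open ≡-Reasoning

  expansion-suc : ∀ b → Atrunc (suc d) b ⊛ qPoch (suc d) ≗ expansion (suc d) b
  expansion-suc b = begin
    Atrunc (suc d) b ⊛ qPoch (suc d)
      ≈⟨ x≈[x-y]+y (Atrunc (suc d) b ⊛ qPoch (suc d)) (expansionTail (suc d) b) ⟩
    (Atrunc (suc d) b ⊛ qPoch (suc d) ⊕ ⊝ expansionTail (suc d) b) ⊕ expansionTail (suc d) b
      ≈⟨ Series.+-congʳ {expansionTail (suc d) b} (Series.trans (Atrunc-minus-tail b)
           (Series.sym (Series.trans (term-zero (suc d) b) α-suc))) ⟩
    term (suc d) b 0 ⊕ expansionTail (suc d) b ∎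
    where open ≗-Reasoning

α-zero : α 0 ≗ oneS
α-zero n = trans (α-Atrunc 0 n) (⊛-identityˡ oneS n)

expansion-holds : ∀ d b → Atrunc d b ⊛ qPoch d ≗ expansion d b
expansion-holds zero    b = begin
  oneS ⊛ oneS      ≈⟨ ⊛-identityˡ oneS ⟩
  oneS             ≈⟨ α-zero ⟨
  α 0              ≈⟨ term-zero 0 b ⟨
  term 0 b 0       ≈⟨ Series.+-identityʳ (term 0 b 0) ⟨
  term 0 b 0 ⊕ 0ₛ  ∎
  where open ≗-Reasoning
expansion-holds (suc d) b = expansion-suc d (expansion-holds d) b

α-recursion : ∀ d → α (suc d) ≗ ⊝ expansionTail (suc d) 0
α-recursion d = α-suc d (expansion-holds d)

-- Evaluation at q = 1

-- PolyAt1 f v : f is a polynomial, of degree at most degreeBound, with f(1) = v.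
record PolyAt1 (f : Series) (v : ℤ) : Set where
  field
    degreeBound : ℕ
    vanishes    : ∀ n → degreeBound < n → f n ≡ + 0
    value       : sumUpTo f degreeBound ≡ v

  value-beyond : ∀ {M} → degreeBound ≤ M → sumUpTo f M ≡ v
  value-beyond N≤M = trans (sumUpTo-beyond f N≤M vanishes) value

open PolyAt1

PolyAt1-cong : ∀ {f g v} → f ≗ g → PolyAt1 f v → PolyAt1 g v
PolyAt1-cong f≗g p = record
  { degreeBound = degreeBound p
  ; vanishes    = λ n N<n → trans (sym (f≗g n)) (vanishes p n N<n)
  ; value       = trans (sumUpTo-cong (degreeBound p) (λ i _ → sym (f≗g i))) (value p)
  }

PolyAt1-0 : PolyAt1 0ₛ (+ 0)
PolyAt1-0 = record { degreeBound = 0 ; vanishes = λ _ _ → refl ; value = refl }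

PolyAt1-1 : PolyAt1 oneS (+ 1)
PolyAt1-1 = record { degreeBound = 0 ; vanishes = λ { (suc n) _ → refl } ; value = refl }

PolyAt1-q^ : ∀ k → PolyAt1 (q^ k) (+ 1)
PolyAt1-q^ k = record
  { degreeBound = k
  ; vanishes    = λ n k<n → q^-off-diagonal k (ℕ.>⇒≢ k<n)
  ; value       = sum-q^ k
  }
  where
  sum-q^ : ∀ k → sumUpTo (q^ k) k ≡ + 1
  sum-q^ zero    = refl
  sum-q^ (suc k) = cong₂ _+_ (sumUpTo-zero k (λ i i≤k → q^-off-diagonal (suc k) (ℕ.<⇒≢ (s≤s i≤k))))
                             (q^-diagonal (suc k))

PolyAt1-⊕ : ∀ {f g v w} → PolyAt1 f v → PolyAt1 g w → PolyAt1 (f ⊕ g) (v + w)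
PolyAt1-⊕ {f} {g} p r = record
  { degreeBound = N
  ; vanishes    = λ n N<n → cong₂ _+_ (vanishes p n (ℕ.≤-<-trans Nₚ≤N N<n)) (vanishes r n (ℕ.≤-<-trans Nᵣ≤N N<n))
  ; value       = trans (sumUpTo-distrib-+ f g N) (cong₂ _+_ (value-beyond p Nₚ≤N) (value-beyond r Nᵣ≤N))
  }
  where
  N = degreeBound p ℕ.+ degreeBound r
  Nₚ≤N = ℕ.m≤m+n (degreeBound p) (degreeBound r)
  Nᵣ≤N = ℕ.m≤n+m (degreeBound r) (degreeBound p)

PolyAt1-⊝ : ∀ {f v} → PolyAt1 f v → PolyAt1 (⊝ f) (- v)
PolyAt1-⊝ {f} p = record
  { degreeBound = degreeBound p
  ; vanishes    = λ n N<n → cong -_ (vanishes p n N<n)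
  ; value       = trans (sumUpTo-neg f (degreeBound p)) (cong -_ (value p))
  }

PolyAt1-⊛ : ∀ {f g v w} → PolyAt1 f v → PolyAt1 g w → PolyAt1 (f ⊛ g) (v * w)
PolyAt1-⊛ {f} {g} {v} {w} p r = record
  { degreeBound = N
  ; vanishes    = λ n N<n → sumUpTo-zero n (λ j _ → product-vanishes N<n j)
  ; value       = begin
      sumUpTo (f ⊛ g) N
        ≡⟨ sumUpTo-cong N (λ i _ → sym (ℤ.*-identityʳ ((f ⊛ g) i))) ⟩
      sumUpTo (λ i → (f ⊛ g) i * + 1) N
        ≡⟨ sumUpTo-⊛ f g (λ _ → + 1) N ⟩
      sumUpTo (λ j → f j * sumUpTo (λ k → g k * + 1) (N ∸ j)) N
        ≡⟨ sumUpTo-cong N (λ j _ → cong (f j *_) (sumUpTo-cong (N ∸ j) (λ k _ → ℤ.*-identityʳ (g k)))) ⟩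
      sumUpTo (λ j → f j * sumUpTo g (N ∸ j)) N
        ≡⟨ sumUpTo-cong N (λ j _ → inner-sum j) ⟩
      sumUpTo (λ j → f j * w) N
        ≡⟨ *-distribʳ-sumUpTo w f N ⟨
      sumUpTo f N * w
        ≡⟨ cong (_* w) (value-beyond p (ℕ.m≤n+m Nₚ Nᵣ)) ⟩
      v * w ∎
  }
  where
  open ≡-Reasoning
  Nₚ = degreeBound p
  Nᵣ = degreeBound r
  N  = Nᵣ ℕ.+ Nₚ
  product-vanishes : ∀ {n} → N < n → ∀ j → f j * g (n ∸ j) ≡ + 0
  product-vanishes {n} N<n j with j ≤? Nₚ
  ... | yes j≤Nₚ = trans (cong (f j *_) (vanishes r (n ∸ j) (ℕ.m+n≤o⇒m≤o∸n (suc Nᵣ)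
                     (ℕ.≤-trans (s≤s (ℕ.+-monoʳ-≤ Nᵣ j≤Nₚ)) N<n)))) (ℤ.*-zeroʳ (f j))
  ... | no  j≰Nₚ = trans (cong (_* g (n ∸ j)) (vanishes p j (ℕ.≰⇒> j≰Nₚ))) (ℤ.*-zeroˡ (g (n ∸ j)))
  inner-sum : ∀ j → f j * sumUpTo g (N ∸ j) ≡ f j * w
  inner-sum j with j ≤? Nₚ
  ... | yes j≤Nₚ = cong (f j *_) (value-beyond r (ℕ.m+n≤o⇒m≤o∸n Nᵣ (ℕ.+-monoʳ-≤ Nᵣ j≤Nₚ)))
  ... | no  j≰Nₚ = begin
    f j * sumUpTo g (N ∸ j) ≡⟨ cong (_* sumUpTo g (N ∸ j)) fj≡0 ⟩
    + 0 * sumUpTo g (N ∸ j) ≡⟨ ℤ.*-zeroˡ (sumUpTo g (N ∸ j)) ⟩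
    + 0                     ≡⟨ ℤ.*-zeroˡ w ⟨
    + 0 * w                 ≡⟨ cong (_* w) fj≡0 ⟨
    f j * w                 ∎
    where fj≡0 = vanishes p j (ℕ.≰⇒> j≰Nₚ)

PolyAt1-sum : ∀ {m} (fs : Fin m → Series) (vs : Fin m → ℤ) →
              (∀ i → PolyAt1 (fs i) (vs i)) → PolyAt1 (Σₛ.sum fs) (Σℤ.sum vs)
PolyAt1-sum {zero}  fs vs ps = PolyAt1-0
PolyAt1-sum {suc m} fs vs ps = PolyAt1-⊕ (ps Fin.zero) (PolyAt1-sum (fs ∘ Fin.suc) (vs ∘ Fin.suc) (ps ∘ Fin.suc))

PolyAt1-sign : ∀ i → PolyAt1 (sign i) (-1ℤ ^ i)
PolyAt1-sign zero    = PolyAt1-1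
PolyAt1-sign (suc i) = subst (PolyAt1 (sign (suc i))) (sym (ℤ.-1*i≡-i (-1ℤ ^ i))) (PolyAt1-⊝ (PolyAt1-sign i))

PolyAt1-qBinomial : ∀ a b → PolyAt1 (qBinomial a b) (+ ((a ℕ.+ b) C a))
PolyAt1-qBinomial zero    b       = PolyAt1-1
PolyAt1-qBinomial (suc a) zero    =
  subst (PolyAt1 oneS) (cong +_ (sym (trans (cong (_C suc a) (ℕ.+-identityʳ (suc a))) (nCn≡1 (suc a))))) PolyAt1-1
PolyAt1-qBinomial (suc a) (suc b) =
  subst (PolyAt1 (qBinomial (suc a) (suc b))) pascal
    (PolyAt1-⊕ (PolyAt1-qBinomial a (suc b)) (PolyAt1-⊛ (PolyAt1-q^ (suc a)) (PolyAt1-qBinomial (suc a) b)))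
  where
  open ≡-Reasoning
  n = a ℕ.+ suc b
  pascal : + (n C a) + + 1 * + ((suc a ℕ.+ b) C suc a) ≡ + (suc n C suc a)
  pascal = begin
    + (n C a) + + 1 * + ((suc a ℕ.+ b) C suc a)
      ≡⟨ cong (λ c → + (n C a) + c) (ℤ.*-identityˡ (+ ((suc a ℕ.+ b) C suc a))) ⟩
    + (n C a) + + ((suc a ℕ.+ b) C suc a)
      ≡⟨ cong (λ m → + (n C a) + + (m C suc a)) (ℕ.+-suc a b) ⟨
    + (n C a) + + (n C suc a)
      ≡⟨ ℤ.pos-+ (n C a) (n C suc a) ⟨
    + (n C a ℕ.+ n C suc a)
      ≡⟨ cong +_ (nCk+nC[k+1]≡[n+1]C[k+1] n a) ⟩
    + (suc n C suc a) ∎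

∑-telescope : ∀ (y : ℕ → ℤ) k → Σℤ.sum {k} (λ i → y (suc (toℕ i)) - y (toℕ i)) ≡ y k - y 0
∑-telescope y zero    = sym (ℤ.+-inverseʳ (y 0))
∑-telescope y (suc k) =
  trans (cong (λ c → (y 1 - y 0) + c) (∑-telescope (y ∘ suc) k)) (cancel (y 1) (y 0) (y (suc k)))
  where
  cancel : ∀ a b c → (a - b) + (c - a) ≡ c - b
  cancel = solve-∀

alternating-binomial-sum : ∀ m → Σℤ.sum {suc m} (λ i → (-1ℤ ^ suc (toℕ i)) * + (suc m C suc (toℕ i))) ≡ -1ℤ
alternating-binomial-sum m = begin
  Σℤ.sum {suc m} (λ i → (-1ℤ ^ suc (toℕ i)) * + (suc m C suc (toℕ i)))
    ≡⟨ Σℤ.sum-cong-≗ {suc m} (λ i → pascal-step (toℕ i)) ⟩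
  Σℤ.sum {suc m} (λ i → y (suc (toℕ i)) - y (toℕ i))
    ≡⟨ ∑-telescope y (suc m) ⟩
  (-1ℤ ^ suc m) * + (m C suc m) - + 1
    ≡⟨ cong (λ c → (-1ℤ ^ suc m) * + c - + 1) (k>n⇒nCk≡0 (ℕ.n<1+n m)) ⟩
  (-1ℤ ^ suc m) * + 0 - + 1
    ≡⟨ cong (_- + 1) (ℤ.*-zeroʳ (-1ℤ ^ suc m)) ⟩
  -1ℤ ∎
  where
  open ≡-Reasoning
  y : ℕ → ℤ
  y i = (-1ℤ ^ i) * + (m C i)
  regroup : ∀ s x x′ → (-1ℤ * s) * (x + x′) ≡ (-1ℤ * s) * x′ - s * x
  regroup = solve-∀
  pascal-step : ∀ i → (-1ℤ ^ suc i) * + (suc m C suc i) ≡ y (suc i) - y i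
  pascal-step i = begin
    (-1ℤ ^ suc i) * + (suc m C suc i)            ≡⟨ cong (λ c → (-1ℤ ^ suc i) * + c) (nCk+nC[k+1]≡[n+1]C[k+1] m i) ⟨
    (-1ℤ ^ suc i) * + (m C i ℕ.+ m C suc i)      ≡⟨ cong ((-1ℤ ^ suc i) *_) (ℤ.pos-+ (m C i) (m C suc i)) ⟩
    (-1ℤ ^ suc i) * (+ (m C i) + + (m C suc i))  ≡⟨ regroup (-1ℤ ^ i) (+ (m C i)) (+ (m C suc i)) ⟩
    y (suc i) - y i                              ∎

PolyAt1-term : ∀ m i → i ≤ m → PolyAt1 (α (m ∸ i)) (+ 1) →
               PolyAt1 (term (suc m) 0 (suc i)) ((-1ℤ ^ suc i) * + (suc m C suc i))
PolyAt1-term m i i≤m α-at-1 = subst (PolyAt1 (term (suc m) 0 (suc i))) simplify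
  (PolyAt1-⊛ (PolyAt1-q^ (exponent (suc i) 0))
             (PolyAt1-⊛ (PolyAt1-sign (suc i)) (PolyAt1-⊛ (PolyAt1-qBinomial (suc i) (m ∸ i)) α-at-1)))
  where
  simplify : + 1 * ((-1ℤ ^ suc i) * (+ ((suc i ℕ.+ (m ∸ i)) C suc i) * + 1)) ≡ (-1ℤ ^ suc i) * + (suc m C suc i)
  simplify = trans (ℤ.*-identityˡ _) (cong ((-1ℤ ^ suc i) *_) (trans (ℤ.*-identityʳ _)
                   (cong (λ n → + (suc n C suc i)) (ℕ.m+[n∸m]≡n i≤m))))

PolyAt1-α : ∀ d → PolyAt1 (α d) (+ 1)
PolyAt1-α = <-rec (λ d → PolyAt1 (α d) (+ 1)) step
  where
  step : ∀ d → (∀ {e} → e < d → PolyAt1 (α e) (+ 1)) → PolyAt1 (α d) (+ 1)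
  step zero    _   = PolyAt1-cong (Series.sym α-zero) PolyAt1-1
  step (suc m) rec = PolyAt1-cong (Series.sym (α-recursion m))
    (subst (PolyAt1 (⊝ expansionTail (suc m) 0)) (cong -_ (alternating-binomial-sum m))
      (PolyAt1-⊝ (PolyAt1-sum _ _ (λ i →
        PolyAt1-term m (toℕ i) (toℕ≤pred[n] i) (rec (s≤s (ℕ.m∸n≤m m (toℕ i))))))))

corollary1 : (d : ℕ) → 1 ≤ d →
    ∃[ N ] ((∀ n → N < n → α d n ≡ + 0) × sumUpTo (α d) N ≡ + 1)
corollary1 d _ = degreeBound α-at-1 , vanishes α-at-1 , value α-at-1
  where α-at-1 = PolyAt1-α d
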